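{- For all $\delta,k\in\mathbb{N}^+$ and $T_{\max}\ge 4$, there is an infinite family of simple temporal graphs $\{\mathcal{G}_n\}_{n\in\mathbb{N}}$ with lifetime $T_{\max}$ such that $\mathcal{G}_n$ has $\Theta(n)$ nodes and the minimum number of rounds required for the Discoverer to win the temporal graph discovery game on $\mathcal{G}_n$ (with parameters $T_{\max},\delta,k$) grows in $\Omega\big(n(T_{\max}-3)/(\delta k)\big)$.
   Context: A simple temporal graph $\mathcal{G}=(V,E,\lambda)$ with lifetime $T_{\max}$ has a finite undirected static graph $(V,E)$ and labeling $\lambda:E\to\{1,\dots,T_{\max}\}$. Infection model with parameter $\delta$: all nodes start susceptible; a seed infection $(v,t)\in V\times[0,T_{\max}]$ makes $v$ infected at time $t$; otherwise a susceptible node $u$ becomes infected at time $t$ iff some node $w$ infectious at time $t$ has an edge $uw$ with $\lambda(uw)=t$ (if several, exactly one infects $u$); a node infected at time $t$ is infectious at times $t+1,\dots,t+\delta$ and resistant afterwards. An infection log is the set of triples $(u,w,s)$ ($u$ infected $w$ at time $s$; seeds as $(u,u,s)$), consistent with a seed set if some chain with these seeds produces it. TGD game with parameters $T_{\max},\delta,k,n$: the Discoverer learns $V$ and the static edge set $E$; in each round it submits at most $k$ seed infections and the Adversary answers with a consistent infection log; to end, the Discoverer submits a temporal graph and the Adversary responds with a temporal graph (same static graph) consistent with all logs so far; the Adversary wins if they differ, otherwise the Discoverer wins. The minimum number of rounds required to win on $\mathcal{G}_n$ is the least $r$ such that some Discoverer strategy wins within $r$ rounds against every Adversary whose answers are consistent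 with labelings of the static graph of $\mathcal{G}_n$. -}

module Defs where

open import Data.Nat using (ℕ; zero; suc; _+_; _*_; _∸_; _≤_; _<_)
open import Data.Fin using (Fin)
open import Data.Product using (Σ; ∃; _×_; _,_; proj₁; proj₂)
open import Data.Sum using (_⊎_)
open import Data.Maybe using (Maybe; just; nothing)
open import Data.List using (List; []; _∷_; length)
open import Data.List.Membership.Propositional using (_∈_)
open import Data.List.Relation.Unary.All using (All)
open import Relation.Binary.PropositionalEquality using (_≡_; _≢_)
open import Relation.Nullary using (¬_)

record StaticGraph : Set where
  field
    nodes : ℕ
    edges : ℕ
    ends  : Fin edges → Fin nodes × Fin nodes

  Joins : Fin edges → Fin nodes → Fin nodes → Set
  Joins e u w = (ends e ≡ (u , w)) ⊎ (ends e ≡ (w , u))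

  field
    loopless : ∀ e → proj₁ (ends e) ≢ proj₂ (ends e)
    noMulti  : ∀ e e' u w → Joins e u w → Joins e' u w → e ≡ e'

open StaticGraph public

Labeling : StaticGraph → ℕ → Set
Labeling G Tmax = Σ (Fin (edges G) → ℕ) λ f → ∀ e → (1 ≤ f e) × (f e ≤ Tmax)

label : ∀ {G : StaticGraph} {Tmax : ℕ} → Labeling G Tmax → Fin (edges G) → ℕ
label = proj₁

record TemporalGraph (Tmax : ℕ) : Set where
  field
    static   : StaticGraph
    labeling : Labeling static Tmax

open TemporalGraph public

Seeds : StaticGraph → Set
Seeds G = List (Fin (nodes G) × ℕ)

-- Since every node is infected at most once, the set
-- of triples (u , w , s) ("u infected w at time s", seeds as (w , w , s))
-- is encoded as a partial function: Log w = just (u , s) iff (u , w , s)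
-- is in the log, and Log w = nothing iff w never gets infected.
Log : StaticGraph → Set
Log G = Fin (nodes G) → Maybe (Fin (nodes G) × ℕ)

module Infection (G : StaticGraph) (δ : ℕ) (f : Fin (edges G) → ℕ)
                 (S : Seeds G) (L : Log G) where

  InfectedAt : Fin (nodes G) → ℕ → Set
  InfectedAt w t = ∃ λ u → L w ≡ just (u , t)

  InfectiousAt : Fin (nodes G) → ℕ → Set
  InfectiousAt w s = ∃ λ t → InfectedAt w t × (t < s) × (s ≤ t + δ)

  InfectsVia : Fin (nodes G) → Fin (nodes G) → ℕ → Set
  InfectsVia w v s = ∃ λ e → Joins G e v w × (f e ≡ s) × InfectiousAt w s

  Exposed : Fin (nodes G) → ℕ → Set
  Exposed v s = ((v , s) ∈ S) ⊎ (∃ λ w → InfectsVia w v s)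

  NodeOK : Fin (nodes G) → Maybe (Fin (nodes G) × ℕ) → Set
  NodeOK v nothing = ∀ s → ¬ Exposed v s
  NodeOK v (just (w , t)) =
    (∀ s → s < t → ¬ Exposed v s) ×
    (((w ≡ v) × ((v , t) ∈ S)) ⊎ InfectsVia w v t)

  Produces : Set
  Produces = ∀ v → NodeOK v (L v)

module Game (G : StaticGraph) (Tmax δ k : ℕ) where

  History : Set
  History = List (Seeds G × Log G)

  ConsistentWith : Labeling G Tmax → Seeds G × Log G → Set
  ConsistentWith λ' (S , L) = Infection.Produces G δ (label {G} {Tmax} λ') S L

  Consistent : Labeling G Tmax → History → Set
  Consistent λ' h = All (ConsistentWith λ') h

  ValidSeeds : Seeds G → Set
  ValidSeeds S = (length S ≤ k) × All (λ p → proj₂ p ≤ Tmax) S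

  -- The Discoverer, with current history h, can force a win within r
  -- further rounds: either it ends now (its guess is the only labeling
  -- consistent with all logs, so the Adversary must return it), or it
  -- submits a valid seed set such that for every Adversary answer that is
  -- consistent (together with the history) with some labeling, it can
  -- win within r-1 further rounds.
  WinsWithin : ℕ → History → Set
  WinsWithin zero h =
    Σ (Labeling G Tmax) λ guess →
      ∀ λ' → Consistent λ' h → ∀ e → label {G} {Tmax} λ' e ≡ label {G} {Tmax} guess e
  WinsWithin (suc r) h =
    WinsWithin r h ⊎
    (Σ (Seeds G) λ S → ValidSeeds S ×
       (∀ L → (Σ (Labeling G Tmax) λ λ' → Consistent λ' ((S , L) ∷ h)) →
              WinsWithin r ((S , L) ∷ h)))

DiscovererWinsWithin : (Tmax δ k : ℕ) → TemporalGraph Tmax → ℕ → Set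
DiscovererWinsWithin Tmax δ k 𝒢 r = Game.WinsWithin (static 𝒢) Tmax δ k r []

{-# OPTIONS --safe #-}
module Submission where

-- Take 𝒢ₙ to be a perfect matching with n edges.  The Adversary keeps, for
-- every edge, a set of candidate labels such that every labeling drawn from
-- the candidate sets is consistent with all logs so far.  A seed on an
-- endpoint of an edge can only reveal the label if it lies in the window of
-- δ time steps in which that endpoint is infectious, so when some candidate
-- outside the windows of the current seeds remains, the Adversary answers as
-- if the label were such a candidate and discards only the candidates inside
-- the windows.  A round of at most k seeds therefore discards at most δk
-- candidates in total, while the Discoverer can only stop once each of the
-- n edges is down to one of its Tmax initial candidates: at least
-- n(Tmax - 1)/(δk) rounds are needed.

open import Defs
open import Data.Nat.Properties
open import Algebra.Properties.Semiring.Sum +-*-semiring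
  using (sum; ∑-distrib-+; *-distribˡ-sum)
open import Data.Bool using (Bool; true; false; T; if_then_else_; _∧_; _∨_; not)
open import Data.Bool.Properties using (T-∨; T-∧)
open import Data.Empty using (⊥-elim)
open import Data.Fin using (Fin; zero; suc; _↑ˡ_; _↑ʳ_; splitAt)
import Data.Fin.Properties as Fin
open import Data.List using (List; []; _∷_; length; applyDownFrom)
open import Data.List.Properties using (length-applyDownFrom)
open import Data.List.Membership.Propositional using (_∈_; _∉_; find; lose)
open import Data.List.Membership.Propositional.Properties
  using (∈-applyDownFrom⁺; ∈-applyDownFrom⁻)
open import Data.List.Relation.Unary.All as All using ([]; _∷_)
open import Data.List.Relation.Unary.Any using (here; there; any?)
open import Data.List.Relation.Unary.Unique.Propositional using (Unique; _∷_)
open import Data.List.Relation.Unary.Unique.Propositional.Properties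
  using (applyDownFrom⁺₁)
open import Data.Maybe using (Maybe; just; nothing; map; maybe)
open import Data.Nat using (ℕ; zero; suc; _+_; _*_; _∸_; _⊓_; _≡ᵇ_; _<ᵇ_; _≤ᵇ_; _≤_; _<_; z≤n; s≤s)
open import Data.Product using (Σ; ∃; _×_; _,_; proj₁; proj₂)
open import Data.Sum using (_⊎_; inj₁; inj₂; [_,_]′; swap)
open import Data.Unit using (tt)
open import Data.Vec.Functional using (updateAt)
open import Data.Vec.Functional.Properties using (updateAt-updates; updateAt-minimal)
open import Function using (_∘_; id; const; Equivalence)
open import Relation.Binary.PropositionalEquality
open import Relation.Nullary using (¬_; yes; no; does)
open import Relation.Nullary.Reflects using (ofʸ; ofⁿ)
open import Relation.Nullary.Decidable using (T?; dec-true)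

sum-mono-≤ : ∀ {m} {f g : Fin m → ℕ} → (∀ i → f i ≤ g i) → sum f ≤ sum g
sum-mono-≤ {zero}  _   = z≤n
sum-mono-≤ {suc m} f≤g = +-mono-≤ (f≤g zero) (sum-mono-≤ (f≤g ∘ suc))

sum-const : ∀ m c → sum {m} (const c) ≡ m * c
sum-const zero    c = refl
sum-const (suc m) c = cong (c +_) (sum-const m c)

sum-↑ : ∀ m {p} (g : Fin (m + p) → ℕ) →
        sum g ≡ sum (λ i → g (i ↑ˡ p)) + sum (λ j → g (m ↑ʳ j))
sum-↑ zero    g = refl
sum-↑ (suc m) g = trans (cong (g zero +_) (sum-↑ m (g ∘ suc))) (sym (+-assoc (g zero) _ _))

sum-suc-at : ∀ {m} (x : Fin m) (g : Fin m → ℕ) →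
             sum (λ v → if does (x Fin.≟ v) then suc (g v) else g v) ≡ suc (sum g)
sum-suc-at zero    g = refl
sum-suc-at (suc x) g = trans (cong (g zero +_) (sum-suc-at x (g ∘ suc))) (+-suc (g zero) _)

count : {A : Set} → (A → Bool) → List A → ℕ
count p []       = 0
count p (x ∷ xs) = if p x then suc (count p xs) else count p xs

module _ {A : Set} where

  count-true : (xs : List A) → count (const true) xs ≡ length xs
  count-true []       = refl
  count-true (x ∷ xs) = cong suc (count-true xs)

  count-none : (p : A → Bool) (xs : List A) → (∀ {x} → x ∈ xs → ¬ T (p x)) → count p xs ≡ 0
  count-none p []       _  = refl
  count-none p (x ∷ xs) ¬p with p x in px
  ... | true  = ⊥-elim (¬p (here refl) (subst T (sym px) tt))
  ... | false = count-none p xs (¬p ∘ there)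

  count-pos : (p : A → Bool) {x : A} {xs : List A} → x ∈ xs → T (p x) → 1 ≤ count p xs
  count-pos p {xs = y ∷ xs} (here refl) px with p y
  ... | true = s≤s z≤n
  count-pos p {xs = y ∷ xs} (there x∈xs) px with p y
  ... | true  = s≤s z≤n
  ... | false = count-pos p x∈xs px

  count-≤1 : (p : A → Bool) {g : A} (xs : List A) → Unique xs →
             (∀ {x} → x ∈ xs → T (p x) → x ≡ g) → count p xs ≤ 1
  count-≤1 p []       _                    _    = z≤n
  count-≤1 p (x ∷ xs) (x∉xs ∷ unique-xs) only with p x in px
  ... | false = count-≤1 p xs unique-xs (only ∘ there)
  ... | true  = s≤s (≤-reflexive (count-none p xs λ y∈xs py →
                  All.lookup x∉xs y∈xs (trans (only (here refl) (subst T (sym px) tt))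
                                              (sym (only (there y∈xs) py)))))

  count-∨ : (p q : A → Bool) (xs : List A) →
            count (λ x → p x ∨ q x) xs ≤ count p xs + count q xs
  count-∨ p q []       = z≤n
  count-∨ p q (x ∷ xs) with p x | q x
  ... | true  | true  = s≤s (≤-trans (count-∨ p q xs) (+-monoʳ-≤ _ (n≤1+n _)))
  ... | true  | false = s≤s (count-∨ p q xs)
  ... | false | true  = ≤-trans (s≤s (count-∨ p q xs)) (≤-reflexive (sym (+-suc _ _)))
  ... | false | false = count-∨ p q xs

  count-∧-not : (p q : A → Bool) (xs : List A) →
                count p xs ≤ count (λ x → p x ∧ not (q x)) xs + count q xs
  count-∧-not p q []       = z≤n
  count-∧-not p q (x ∷ xs) with p x | q x
  ... | true  | true  = ≤-trans (s≤s (count-∧-not p q xs)) (≤-reflexive (sym (+-suc _ _)))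
  ... | true  | false = s≤s (count-∧-not p q xs)
  ... | false | true  = ≤-trans (count-∧-not p q xs) (+-monoʳ-≤ _ (n≤1+n _))
  ... | false | false = count-∧-not p q xs

labels : ℕ → List ℕ
labels = applyDownFrom suc

∈-labels⁻ : ∀ {ℓ m} → ℓ ∈ labels m → 1 ≤ ℓ × ℓ ≤ m
∈-labels⁻ ℓ∈ with _ , i<m , refl ← ∈-applyDownFrom⁻ suc ℓ∈ = s≤s z≤n , i<m

labels-unique : ∀ m → Unique (labels m)
labels-unique m = applyDownFrom⁺₁ suc m (λ j<i _ → >⇒≢ j<i ∘ suc-injective)

-- Shrinking a set C of candidates after the labels in P have been probed:
-- the candidates that survive are either all unprobed, so that no probe can
-- tell them apart, or a single one.
record Refinement (xs : List ℕ) (C P : ℕ → Bool) : Set where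
  field
    C′        : ℕ → Bool
    chosen    : ℕ
    chosen∈xs : chosen ∈ xs
    chosen∈C′ : T (C′ chosen)
    C′⊆C      : ∀ {x} → T (C′ x) → T (C x)
    blind     : ∀ {x} → T (C′ x) → x ≡ chosen ⊎ (¬ T (P x) × ¬ T (P chosen))
    count-≤   : count C xs ≤ count C′ xs + count P xs

refine : ∀ xs (C P : ℕ → Bool) → (∃ λ x → x ∈ xs × T (C x)) → Refinement xs C P
refine xs C P (x₀ , x₀∈xs , Cx₀) with any? (λ x → T? (C x ∧ not (P x))) xs
... | yes unprobed with μ , μ∈xs , Cμ ← find unprobed = record
  { C′        = λ x → C x ∧ not (P x)
  ; chosen    = μ
  ; chosen∈xs = μ∈xs
  ; chosen∈C′ = Cμ
  ; C′⊆C      = proj₁ ∘ T-∧-not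
  ; blind     = λ c → inj₂ (proj₂ (T-∧-not c) , proj₂ (T-∧-not Cμ))
  ; count-≤   = count-∧-not C P xs
  }
  where
  T-∧-not : ∀ {a b} → T (a ∧ not b) → T a × ¬ T b
  T-∧-not {true} {false} _ = tt , λ ()
... | no all-probed = record
  { C′        = _≡ᵇ x₀
  ; chosen    = x₀
  ; chosen∈xs = x₀∈xs
  ; chosen∈C′ = ≡⇒≡ᵇ x₀ x₀ refl
  ; C′⊆C      = λ {x} x≡x₀ → subst (T ∘ C) (sym (≡ᵇ⇒≡ x x₀ x≡x₀)) Cx₀
  ; blind     = λ {x} x≡x₀ → inj₁ (≡ᵇ⇒≡ x x₀ x≡x₀)
  ; count-≤   = ≤-trans (count-∧-not C P xs) (+-monoˡ-≤ _ (≤-trans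
                  (≤-reflexive (count-none _ xs λ x∈xs c → all-probed (lose x∈xs c))) z≤n))
  }

module Window (δ : ℕ) where

  -- inWindow b ℓ: a node whose earliest seed is b (if any) is infectious at
  -- time ℓ, unless a neighbour infected it before that seed.
  inWindow : Maybe ℕ → ℕ → Bool
  inWindow nothing  ℓ = false
  inWindow (just t) ℓ = (t <ᵇ ℓ) ∧ (ℓ ≤ᵇ t + δ)

  inWindow⁺ : ∀ {t ℓ} → t < ℓ → ℓ ≤ t + δ → T (inWindow (just t) ℓ)
  inWindow⁺ t<ℓ ℓ≤t+δ = Equivalence.from T-∧ (<⇒<ᵇ t<ℓ , ≤⇒≤ᵇ ℓ≤t+δ)

  inWindow⁻ : ∀ b ℓ → T (inWindow b ℓ) → ∃ λ t → b ≡ just t × t < ℓ × ℓ ≤ t + δ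
  inWindow⁻ (just t) ℓ w with lt , le ← Equivalence.to T-∧ w =
    t , refl , <ᵇ⇒< t ℓ lt , ≤ᵇ⇒≤ ℓ (t + δ) le

  count-window-≤∸ : ∀ t m → count (inWindow (just t)) (labels m) ≤ m ∸ t
  count-window-≤∸ t zero = z≤n
  count-window-≤∸ t (suc m)
    with t <ᵇ suc m | <ᵇ-reflects-< t (suc m) | suc m ≤ᵇ t + δ
  ... | true  | ofʸ (s≤s t≤m) | true  =
        ≤-trans (s≤s (count-window-≤∸ t m)) (≤-reflexive (sym (+-∸-assoc 1 t≤m)))
  ... | true  | _ | false = ≤-trans (count-window-≤∸ t m) (∸-monoˡ-≤ t (n≤1+n m))
  ... | false | _ | _     = ≤-trans (count-window-≤∸ t m) (∸-monoˡ-≤ t (n≤1+n m))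

  count-window-≤δ : ∀ t m → count (inWindow (just t)) (labels m) ≤ δ
  count-window-≤δ t zero = z≤n
  count-window-≤δ t (suc m)
    with t <ᵇ suc m | <ᵇ-reflects-< t (suc m) | suc m ≤ᵇ t + δ | ≤ᵇ-reflects-≤ (suc m) (t + δ)
  ... | true | ofʸ (s≤s t≤m) | true | ofʸ 1+m≤t+δ = begin
    suc (count (inWindow (just t)) (labels m)) ≤⟨ s≤s (count-window-≤∸ t m) ⟩
    suc (m ∸ t)                               ≡⟨ +-∸-assoc 1 t≤m ⟨
    suc m ∸ t                                 ≤⟨ ∸-monoˡ-≤ t 1+m≤t+δ ⟩
    t + δ ∸ t                                 ≡⟨ m+n∸m≡n t δ ⟩
    δ                                         ∎
    where open ≤-Reasoning
  ... | true  | _ | false | _ = count-window-≤δ t m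
  ... | false | _ | _     | _ = count-window-≤δ t m

  before : ℕ → Maybe ℕ → Bool
  before ℓ nothing  = true
  before ℓ (just a) = ℓ <ᵇ a

  -- The log entry of a node s whose only edge, labelled ℓ, joins it to o,
  -- when s and o are first seeded at times a and b.
  matchLog : {A : Set} → Maybe ℕ → Maybe ℕ → ℕ → A → A → Maybe (A × ℕ)
  matchLog a b ℓ s o = if inWindow b ℓ ∧ before ℓ a then just (o , ℓ) else map (s ,_) a

  module _ {A : Set} where

    matchLog-unexposed : ∀ a b ℓ {s o : A} → ¬ T (inWindow b ℓ) →
                         matchLog a b ℓ s o ≡ map (s ,_) a
    matchLog-unexposed a b ℓ ¬w with inWindow b ℓ
    ... | true  = ⊥-elim (¬w tt)
    ... | false = refl

    matchLog-seeded : ∀ a b ℓ {s o : A} → b < ℓ → matchLog (just b) a ℓ o s ≡ just (o , b)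
    matchLog-seeded a b ℓ b<ℓ with inWindow a ℓ | ℓ <ᵇ b | <ᵇ-reflects-< ℓ b
    ... | true  | true  | ofʸ ℓ<b = ⊥-elim (<-asym b<ℓ ℓ<b)
    ... | true  | false | _       = refl
    ... | false | _     | _       = refl

    -- Infection over the edge itself happens only at time ℓ, so a node
    -- infectious at ℓ got there through its own seed.
    matchLog-infectious : ∀ a b ℓ {s o u : A} {t} → matchLog b a ℓ o s ≡ just (u , t) →
                          t < ℓ → ℓ ≤ t + δ → T (inWindow b ℓ)
    matchLog-infectious a b ℓ eq t<ℓ ℓ≤t+δ with inWindow a ℓ ∧ before ℓ b
    matchLog-infectious a b ℓ refl t<ℓ ℓ≤t+δ | true = ⊥-elim (<-irrefl refl t<ℓ)
    matchLog-infectious a (just t) ℓ refl t<ℓ ℓ≤t+δ | false = inWindow⁺ t<ℓ ℓ≤t+δ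

module _ {m : ℕ} where

  earliest : Fin m → List (Fin m × ℕ) → Maybe ℕ
  earliest v []             = nothing
  earliest v ((x , t) ∷ S) with x Fin.≟ v
  ... | yes _ = just (maybe (t ⊓_) t (earliest v S))
  ... | no _  = earliest v S

  EarliestSeed : List (Fin m × ℕ) → Fin m → Maybe ℕ → Set
  EarliestSeed S v nothing  = ∀ s → (v , s) ∉ S
  EarliestSeed S v (just a) = (v , a) ∈ S × (∀ {s} → (v , s) ∈ S → a ≤ s)

  earliest-spec : ∀ v S → EarliestSeed S v (earliest v S)
  earliest-spec v []             = λ _ ()
  earliest-spec v ((x , t) ∷ S) with x Fin.≟ v
  ... | yes refl = cons-earlier (earliest v S) (earliest-spec v S)
    where
    cons-earlier : ∀ a → EarliestSeed S v a → EarliestSeed ((v , t) ∷ S) v (just (maybe (t ⊓_) t a))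
    cons-earlier nothing unseeded =
        here refl
      , λ { (here refl) → ≤-refl ; (there v∈S) → ⊥-elim (unseeded _ v∈S) }
    cons-earlier (just a) (a∈S , a≤) =
        [ (λ eq → here (cong (v ,_) eq)) , (λ eq → there (subst (λ z → (v , z) ∈ S) (sym eq) a∈S)) ]′
          (⊓-sel t a)
      , λ { (here refl) → m⊓n≤m t a ; (there v∈S) → ≤-trans (m⊓n≤n t a) (a≤ v∈S) }
  ... | no x≢v = cons-other (earliest v S) (earliest-spec v S)
    where
    other : ∀ {s} → (v , s) ≢ (x , t)
    other eq = x≢v (sym (cong proj₁ eq))
    cons-other : ∀ a → EarliestSeed S v a → EarliestSeed ((x , t) ∷ S) v a
    cons-other nothing  unseeded   = λ { s (here eq) → other eq ; s (there v∈S) → unseeded s v∈S }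
    cons-other (just a) (a∈S , a≤) =
      there a∈S , λ { (here eq) → ⊥-elim (other eq) ; (there v∈S) → a≤ v∈S }

  seedsAt : Fin m → List (Fin m × ℕ) → ℕ
  seedsAt v = count (λ seed → does (proj₁ seed Fin.≟ v))

  seedsAt-pos : ∀ {v t S} → (v , t) ∈ S → 1 ≤ seedsAt v S
  seedsAt-pos {v} v∈S = count-pos _ v∈S (subst T (sym (dec-true (v Fin.≟ v) refl)) tt)

  sum-seedsAt : ∀ S → sum (λ v → seedsAt v S) ≡ length S
  sum-seedsAt []            = trans (sum-const m 0) (*-zeroʳ m)
  sum-seedsAt ((x , t) ∷ S) = trans (sum-suc-at x (λ v → seedsAt v S)) (cong suc (sum-seedsAt S))

module Matching (n : ℕ) where

  V : Set
  V = Fin (n + n)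

  matchEnds : Fin n → V × V
  matchEnds e = e ↑ˡ n , n ↑ʳ e

  edgeOf : V → Fin n
  edgeOf v = [ id , id ]′ (splitAt n v)

  partner : V → V
  partner v = [ n ↑ʳ_ , _↑ˡ n ]′ (splitAt n v)

  endpoint : ∀ v → (∃ λ e → v ≡ e ↑ˡ n) ⊎ (∃ λ e → v ≡ n ↑ʳ e)
  endpoint v with splitAt n v in eq
  ... | inj₁ e = inj₁ (e , sym (Fin.splitAt⁻¹-↑ˡ eq))
  ... | inj₂ e = inj₂ (e , sym (Fin.splitAt⁻¹-↑ʳ eq))

  edgeOf-↑ˡ : ∀ e → edgeOf (e ↑ˡ n) ≡ e
  edgeOf-↑ˡ e = cong [ id , id ]′ (Fin.splitAt-↑ˡ n e n)

  edgeOf-↑ʳ : ∀ e → edgeOf (n ↑ʳ e) ≡ e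
  edgeOf-↑ʳ e = cong [ id , id ]′ (Fin.splitAt-↑ʳ n n e)

  partner-↑ˡ : ∀ e → partner (e ↑ˡ n) ≡ n ↑ʳ e
  partner-↑ˡ e = cong [ n ↑ʳ_ , _↑ˡ n ]′ (Fin.splitAt-↑ˡ n e n)

  partner-↑ʳ : ∀ e → partner (n ↑ʳ e) ≡ e ↑ˡ n
  partner-↑ʳ e = cong [ n ↑ʳ_ , _↑ˡ n ]′ (Fin.splitAt-↑ʳ n n e)

  ↑ˡ≢↑ʳ : ∀ e → e ↑ˡ n ≢ n ↑ʳ e
  ↑ˡ≢↑ʳ e eq
    with () ← trans (sym (Fin.splitAt-↑ˡ n e n)) (trans (cong (splitAt n) eq) (Fin.splitAt-↑ʳ n n e))

  matchEnds-unique : ∀ {e v w} → matchEnds e ≡ (v , w) ⊎ matchEnds e ≡ (w , v) →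
                     e ≡ edgeOf v × w ≡ partner v
  matchEnds-unique (inj₁ refl) = sym (edgeOf-↑ˡ _) , sym (partner-↑ˡ _)
  matchEnds-unique (inj₂ refl) = sym (edgeOf-↑ʳ _) , sym (partner-↑ʳ _)

  matching : StaticGraph
  matching = record
    { nodes    = n + n
    ; edges    = n
    ; ends     = matchEnds
    ; loopless = ↑ˡ≢↑ʳ
    ; noMulti  = λ e e′ u w J J′ →
                   trans (proj₁ (matchEnds-unique J)) (sym (proj₁ (matchEnds-unique J′)))
    }

  joins-partner : ∀ v → Joins matching (edgeOf v) v (partner v)
  joins-partner v with endpoint v
  ... | inj₁ (e , refl) rewrite edgeOf-↑ˡ e | partner-↑ˡ e = inj₁ refl
  ... | inj₂ (e , refl) rewrite edgeOf-↑ʳ e | partner-↑ʳ e = inj₂ refl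

  edgeOf-partner : ∀ v → edgeOf v ≡ edgeOf (partner v)
  edgeOf-partner v = proj₁ (matchEnds-unique (swap (joins-partner v)))

  partner-partner : ∀ v → v ≡ partner (partner v)
  partner-partner v = proj₂ (matchEnds-unique (swap (joins-partner v)))

  module Play (δ : ℕ) (S : Seeds matching) where
    open Window δ

    matchingLog : (Fin n → ℕ) → Log matching
    matchingLog f v = matchLog (earliest v S) (earliest (partner v) S) (f (edgeOf v)) v (partner v)

    matchingLog-partner : ∀ f v → matchingLog f (partner v) ≡
      matchLog (earliest (partner v) S) (earliest v S) (f (edgeOf v)) (partner v) v
    matchingLog-partner f v =
      cong₂ (λ w e → matchLog (earliest (partner v) S) (earliest w S) (f e) (partner v) w)
            (sym (partner-partner v)) (sym (edgeOf-partner v))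

    module _ (f : Fin n → ℕ) (L : Log matching) (f≗L : matchingLog f ≗ L) where
      open Infection matching δ f S L

      via-partner : ∀ {v s} → (∃ λ w → InfectsVia w v s) →
                    s ≡ f (edgeOf v) × T (inWindow (earliest (partner v) S) (f (edgeOf v)))
      via-partner {v} (w , e , J , refl , t , (u , Lw≡) , t<s , s≤t+δ) with matchEnds-unique J
      ... | refl , refl =
        refl , matchLog-infectious (earliest v S) (earliest (partner v) S) (f (edgeOf v))
                 (trans (sym (matchingLog-partner f v)) (trans (f≗L (partner v)) Lw≡)) t<s s≤t+δ

      partner-infects : ∀ v → T (inWindow (earliest (partner v) S) (f (edgeOf v))) →
                        InfectsVia (partner v) v (f (edgeOf v))
      partner-infects v w
        with b , b≡ , b<ℓ , ℓ≤b+δ ← inWindow⁻ (earliest (partner v) S) (f (edgeOf v)) w =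
        edgeOf v , joins-partner v , refl , b , (partner v , seeded) , b<ℓ , ℓ≤b+δ
        where
        seeded : L (partner v) ≡ just (partner v , b)
        seeded = begin
          L (partner v)                   ≡⟨ f≗L (partner v) ⟨
          matchingLog f (partner v)       ≡⟨ matchingLog-partner f v ⟩
          matchLog (earliest (partner v) S) (earliest v S) (f (edgeOf v)) (partner v) v
            ≡⟨ cong (λ b → matchLog b (earliest v S) (f (edgeOf v)) (partner v) v) b≡ ⟩
          matchLog (just b) (earliest v S) (f (edgeOf v)) (partner v) v
            ≡⟨ matchLog-seeded (earliest v S) b (f (edgeOf v)) b<ℓ ⟩
          just (partner v , b)            ∎
          where open ≡-Reasoning

      no-via-before : ∀ {v s} → s < f (edgeOf v) → ¬ ∃ λ w → InfectsVia w v s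
      no-via-before s<ℓ via = <-irrefl (proj₁ (via-partner via)) s<ℓ

      no-via-unexposed : ∀ {v s} → ¬ T (inWindow (earliest (partner v) S) (f (edgeOf v))) →
                         ¬ ∃ λ w → InfectsVia w v s
      no-via-unexposed ¬w via = ¬w (proj₂ (via-partner via))

      nodeOK : ∀ v → NodeOK v (matchingLog f v)
      nodeOK v with earliest v S | earliest-spec v S
                  | inWindow (earliest (partner v) S) (f (edgeOf v)) in exposed
      ... | nothing | unseeded | true =
            (λ s s<ℓ → [ unseeded s , no-via-before s<ℓ ]′)
          , inj₂ (partner-infects v (subst T (sym exposed) tt))
      ... | nothing | unseeded | false =
            λ s → [ unseeded s , no-via-unexposed (subst T exposed) ]′
      ... | just a | (a∈S , a≤) | false =
            (λ s s<a → [ <⇒≱ s<a ∘ a≤ , no-via-unexposed (subst T exposed) ]′)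
          , inj₁ (refl , a∈S)
      ... | just a | (a∈S , a≤) | true with f (edgeOf v) <ᵇ a | <ᵇ-reflects-< (f (edgeOf v)) a
      ...   | true  | ofʸ ℓ<a =
              (λ s s<ℓ → [ <⇒≱ (<-trans s<ℓ ℓ<a) ∘ a≤ , no-via-before s<ℓ ]′)
            , inj₂ (partner-infects v (subst T (sym exposed) tt))
      ...   | false | ofⁿ ℓ≮a =
              (λ s s<a → [ <⇒≱ s<a ∘ a≤
                         , (λ via → ℓ≮a (subst (_< a) (proj₁ (via-partner via)) s<a)) ]′)
            , inj₁ (refl , a∈S)

      produces : Produces
      produces v = subst (NodeOK v) (f≗L v) (nodeOK v)

    probed : Fin n → ℕ → Bool
    probed e ℓ = inWindow (earliest (e ↑ˡ n) S) ℓ ∨ inWindow (earliest (n ↑ʳ e) S) ℓ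

    probed-partner : ∀ v ℓ → T (inWindow (earliest (partner v) S) ℓ) → T (probed (edgeOf v) ℓ)
    probed-partner v ℓ with endpoint v
    ... | inj₁ (e , refl) rewrite edgeOf-↑ˡ e | partner-↑ˡ e = Equivalence.from T-∨ ∘ inj₂
    ... | inj₂ (e , refl) rewrite edgeOf-↑ʳ e | partner-↑ʳ e = Equivalence.from T-∨ ∘ inj₁

    matchingLog-cong : ∀ f g → (∀ e → f e ≡ g e ⊎ (¬ T (probed e (f e)) × ¬ T (probed e (g e)))) →
                       matchingLog f ≗ matchingLog g
    matchingLog-cong f g same v with same (edgeOf v)
    ... | inj₁ f≡g = cong (λ ℓ → matchLog a b ℓ v (partner v)) f≡g
      where a = earliest v S; b = earliest (partner v) S
    ... | inj₂ (¬pf , ¬pg) =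
      trans (matchLog-unexposed a b (f (edgeOf v)) (¬pf ∘ probed-partner v _))
            (sym (matchLog-unexposed a b (g (edgeOf v)) (¬pg ∘ probed-partner v _)))
      where a = earliest v S; b = earliest (partner v) S

    count-window-earliest : ∀ v m → count (inWindow (earliest v S)) (labels m) ≤ δ * seedsAt v S
    count-window-earliest v m with earliest v S | earliest-spec v S
    ... | nothing | _       = ≤-trans (≤-reflexive (count-none _ (labels m) λ _ ())) z≤n
    ... | just t  | t∈S , _ = begin
      count (inWindow (just t)) (labels m) ≤⟨ count-window-≤δ t m ⟩
      δ                                    ≡⟨ *-identityʳ δ ⟨
      δ * 1                                ≤⟨ *-monoʳ-≤ δ (seedsAt-pos t∈S) ⟩
      δ * seedsAt v S                      ∎
      where open ≤-Reasoning

    sum-count-probed : ∀ m → sum (λ e → count (probed e) (labels m)) ≤ δ * length S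
    sum-count-probed m = begin
      sum (λ e → count (probed e) (labels m)) ≤⟨ sum-mono-≤ count-probed ⟩
      sum (λ e → δ * (seedsˡ e + seedsʳ e))   ≡⟨ *-distribˡ-sum {n} δ (λ e → seedsˡ e + seedsʳ e) ⟨
      δ * sum (λ e → seedsˡ e + seedsʳ e)     ≡⟨ cong (δ *_) (∑-distrib-+ seedsˡ seedsʳ) ⟩
      δ * (sum seedsˡ + sum seedsʳ)           ≡⟨ cong (δ *_) (sum-↑ n (λ v → seedsAt v S)) ⟨
      δ * sum (λ v → seedsAt v S)             ≡⟨ cong (δ *_) (sum-seedsAt S) ⟩
      δ * length S                            ∎
      where
      open ≤-Reasoning
      seedsˡ seedsʳ : Fin n → ℕ
      seedsˡ e = seedsAt (e ↑ˡ n) S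
      seedsʳ e = seedsAt (n ↑ʳ e) S
      count-probed : ∀ e → count (probed e) (labels m) ≤ δ * (seedsˡ e + seedsʳ e)
      count-probed e = begin
        count (probed e) (labels m)
          ≤⟨ count-∨ _ _ (labels m) ⟩
        count (inWindow (earliest (e ↑ˡ n) S)) (labels m)
          + count (inWindow (earliest (n ↑ʳ e) S)) (labels m)
          ≤⟨ +-mono-≤ (count-window-earliest (e ↑ˡ n) m) (count-window-earliest (n ↑ʳ e) m) ⟩
        δ * seedsˡ e + δ * seedsʳ e
          ≡⟨ *-distribˡ-+ δ (seedsˡ e) (seedsʳ e) ⟨
        δ * (seedsˡ e + seedsʳ e) ∎

module Adversary (n δ k Tmax : ℕ) where
  open Matching n
  open Game matching Tmax δ k

  Candidates : Set
  Candidates = Fin n → ℕ → Bool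

  size : Candidates → ℕ
  size C = sum (λ e → count (C e) (labels Tmax))

  record Invariant (h : History) (C : Candidates) : Set where
    field
      sound    : ∀ λ′ → (∀ e → T (C e (proj₁ λ′ e))) → Consistent λ′ h
      nonempty : ∀ e → ∃ λ ℓ → ℓ ∈ labels Tmax × T (C e ℓ)

  toLabeling : (μ : Fin n → ℕ) → (∀ e → μ e ∈ labels Tmax) → Labeling matching Tmax
  toLabeling μ μ∈labels = μ , λ e → ∈-labels⁻ (μ∈labels e)

  won⇒size≤n : ∀ {h C} → Invariant h C → WinsWithin 0 h → size C ≤ n
  won⇒size≤n {C = C} inv (guess , forced) = begin
    size C            ≤⟨ sum-mono-≤ (λ e → count-≤1 (C e) (labels Tmax) (labels-unique Tmax)
                                                 (forced-at e)) ⟩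
    sum {n} (const 1) ≡⟨ sum-const n 1 ⟩
    n * 1             ≡⟨ *-identityʳ n ⟩
    n                 ∎
    where
    open ≤-Reasoning
    open Invariant inv
    default : Fin n → ℕ
    default e = proj₁ (nonempty e)
    pin : Fin n → ℕ → Fin n → ℕ
    pin e ℓ = updateAt default e (const ℓ)
    pin-preserves : (P : Fin n → ℕ → Set) → ∀ {e ℓ} → P e ℓ → (∀ e′ → P e′ (default e′)) →
                    ∀ e′ → P e′ (pin e ℓ e′)
    pin-preserves P {e} Pℓ Pdefault e′ with e′ Fin.≟ e
    ... | yes refl = subst (P e) (sym (updateAt-updates e default)) Pℓ
    ... | no e′≢e  = subst (P e′) (sym (updateAt-minimal e′ e default e′≢e)) (Pdefault e′)
    forced-at : ∀ e {ℓ} → ℓ ∈ labels Tmax → T (C e ℓ) → ℓ ≡ proj₁ guess e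
    forced-at e {ℓ} ℓ∈labels Cℓ =
      trans (sym (updateAt-updates e default)) (forced λ′ (sound λ′ pin∈C) e)
      where
      λ′ : Labeling matching Tmax
      λ′ = toLabeling (pin e ℓ)
             (pin-preserves (λ _ ℓ → ℓ ∈ labels Tmax) ℓ∈labels (proj₁ ∘ proj₂ ∘ nonempty))
      pin∈C : ∀ e′ → T (C e′ (pin e ℓ e′))
      pin∈C = pin-preserves (λ e ℓ → T (C e ℓ)) Cℓ (proj₂ ∘ proj₂ ∘ nonempty)

  module Round {h C} (inv : Invariant h C) (S : Seeds matching) where
    open Invariant inv
    open Play δ S

    refinement : ∀ e → Refinement (labels Tmax) (C e) (probed e)
    refinement e = refine (labels Tmax) (C e) (probed e) (nonempty e)

    module R e = Refinement (refinement e)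

    C′ : Candidates
    C′ e = R.C′ e

    μ : Fin n → ℕ
    μ e = R.chosen e

    answer : Log matching
    answer = matchingLog μ

    invariant′ : Invariant ((S , answer) ∷ h) C′
    invariant′ = record
      { sound    = λ λ′ λ′∈C′ →
          produces (proj₁ λ′) answer (matchingLog-cong (proj₁ λ′) μ (λ e → R.blind e (λ′∈C′ e)))
          ∷ sound λ′ (λ e → R.C′⊆C e (λ′∈C′ e))
      ; nonempty = λ e → μ e , R.chosen∈xs e , R.chosen∈C′ e
      }

    answer-consistent : Σ (Labeling matching Tmax) λ λ′ → Consistent λ′ ((S , answer) ∷ h)
    answer-consistent = λ′ , Invariant.sound invariant′ λ′ R.chosen∈C′
      where
      λ′ : Labeling matching Tmax
      λ′ = toLabeling μ R.chosen∈xs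

    size-drop : size C ≤ size C′ + δ * length S
    size-drop = begin
      size C                               ≤⟨ sum-mono-≤ R.count-≤ ⟩
      sum (λ e → count′ e + probedCount e) ≡⟨ ∑-distrib-+ count′ probedCount ⟩
      size C′ + sum probedCount            ≤⟨ +-monoʳ-≤ (size C′) (sum-count-probed Tmax) ⟩
      size C′ + δ * length S               ∎
      where
      open ≤-Reasoning
      count′ probedCount : Fin n → ℕ
      count′ e = count (C′ e) (labels Tmax)
      probedCount e = count (probed e) (labels Tmax)

  winsWithin⇒size≤ : ∀ r {h C} → Invariant h C → WinsWithin r h → size C ≤ n + r * (δ * k)
  winsWithin⇒size≤ zero    inv win        = ≤-trans (won⇒size≤n inv win) (m≤m+n n 0)
  winsWithin⇒size≤ (suc r) inv (inj₁ win) =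
    ≤-trans (winsWithin⇒size≤ r inv win) (+-monoʳ-≤ n (*-monoˡ-≤ (δ * k) (n≤1+n r)))
  winsWithin⇒size≤ (suc r) {C = C} inv (inj₂ (S , (|S|≤k , _) , continue)) = begin
    size C                    ≤⟨ size-drop ⟩
    size C′ + δ * length S    ≤⟨ +-mono-≤ (winsWithin⇒size≤ r invariant′ (continue answer answer-consistent))
                                          (*-monoʳ-≤ δ |S|≤k) ⟩
    n + r * (δ * k) + δ * k   ≡⟨ +-assoc n _ _ ⟩
    n + (r * (δ * k) + δ * k) ≡⟨ cong (n +_) (+-comm (r * (δ * k)) (δ * k)) ⟩
    n + suc r * (δ * k)       ∎
    where
    open ≤-Reasoning
    open Round inv S

  rounds-lower-bound : 1 ≤ Tmax → ∀ r → WinsWithin r [] → n * (Tmax ∸ 1) ≤ r * (δ * k)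
  rounds-lower-bound 1≤Tmax r win = begin
    n * (Tmax ∸ 1)                 ≡⟨ *-distribˡ-∸ n Tmax 1 ⟩
    n * Tmax ∸ n * 1               ≡⟨ cong (n * Tmax ∸_) (*-identityʳ n) ⟩
    n * Tmax ∸ n                   ≡⟨ cong (_∸ n) size-everything ⟨
    size everything ∸ n            ≤⟨ ∸-monoˡ-≤ n (winsWithin⇒size≤ r initial win) ⟩
    n + r * (δ * k) ∸ n            ≡⟨ m+n∸m≡n n _ ⟩
    r * (δ * k)                    ∎
    where
    open ≤-Reasoning
    everything : Candidates
    everything _ _ = true
    initial : Invariant [] everything
    initial = record
      { sound    = λ _ _ → []
      ; nonempty = λ _ → 1 , ∈-applyDownFrom⁺ suc 1≤Tmax , tt
      }
    size-everything : size everything ≡ n * Tmax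
    size-everything = trans (sum-const n _)
      (cong (n *_) (trans (count-true (labels Tmax)) (length-applyDownFrom suc Tmax)))

-- The labels are irrelevant: the Discoverer only ever sees the static graph.
matchingGraph : ∀ Tmax → 1 ≤ Tmax → ℕ → TemporalGraph Tmax
matchingGraph Tmax 1≤Tmax n = record
  { static   = Matching.matching n
  ; labeling = const 1 , const (≤-refl , 1≤Tmax)
  }

theorem5 :
    ∃ λ p → ∃ λ q → (1 ≤ p) ×
      (∀ δ k Tmax → 1 ≤ δ → 1 ≤ k → 4 ≤ Tmax →
        Σ (ℕ → TemporalGraph Tmax) λ 𝒢 →
          (∃ λ a → ∃ λ b → ∃ λ n₀ → ∀ n → n₀ ≤ n →
             (n ≤ a * nodes (static (𝒢 n))) × (nodes (static (𝒢 n)) ≤ b * n))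
          ×
          (∃ λ n₀ → ∀ n → n₀ ≤ n → ∀ r →
             DiscovererWinsWithin Tmax δ k (𝒢 n) r →
             p * (n * (Tmax ∸ 3)) ≤ q * (r * (δ * k))))
theorem5 = 1 , 1 , ≤-refl , λ δ k Tmax _ _ 4≤Tmax →
  let 1≤Tmax = ≤-trans (s≤s z≤n) 4≤Tmax in
    matchingGraph Tmax 1≤Tmax
  , (1 , 2 , 0 , λ n _ → ≤-trans (m≤m+n n n) (≤-reflexive (sym (*-identityˡ (n + n))))
                       , ≤-reflexive (cong (n +_) (sym (+-identityʳ n))))
  , (0 , λ n _ r win → *-monoʳ-≤ 1 (≤-trans (*-monoʳ-≤ n (∸-monoʳ-≤ Tmax (s≤s z≤n)))
                                            (Adversary.rounds-lower-bound n δ k Tmax 1≤Tmax r win)))
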